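{- Let $T$ be a benign 12-SV table of shape $\lambda/\mu$ and let $k$ be a descent of $T$. Then: (1) $\mathrm{ceq}(\mathrm{res}_k(T))=\mathrm{ceq}(T)$, $\mathrm{ex}(\mathrm{res}_k(T))=\mathrm{ex}(T)$ and $\mathrm{ircont}(\mathrm{res}_k(T))=\mathrm{ircont}(T)$; (2) $k$ is a descent of $\mathrm{flip}(\mathrm{res}_k(T))$, and $\mathrm{res}_k(\mathrm{flip}(\mathrm{res}_k(T)))=\mathrm{flip}(T)$; (3) $\ell(T)>\ell(\mathrm{res}_k(T))$.
   Context: Boxes are $(i,j)$ (row $i$, column $j$); $\lambda/\mu$ is a skew diagram. A 12-SV table of shape $\lambda/\mu$ is a filling $T$ of the boxes by nonempty subsets of $\{1,2\}$ that weakly increase down each column (max of a box $\le$ min of the box below); rows are unrestricted. Statistics (defined for any such filling): $\mathrm{ircont}(T)=(r_1,r_2,\ldots)$, $r_k$ = number of columns containing a box whose set contains $k$; $\mathrm{ceq}(T)=(c_i)$, $c_i$ = number of boxes $(i,j)$ with $(i+1,j)\in\lambda/\mu$ and $\max T(i,j)=\min T(i+1,j)$; $\mathrm{ex}(T)=(e_i)$, $e_i=\sum_{(i,j)\in\lambda/\mu}(|T(i,j)|-1)$. A nonempty column is 1-pure if all its sets are $\{1\}$, 2-pure if all are $\{2\}$, mixed otherwise. For a mixed column $k$, $\mathrm{sep}_k(T)$ is the smallest row $r$ with $2\in T(r,k)$. If the mixed columns are $k_1<\cdots<k_p$, $T$ is benign if $\mathrm{sep}_{k_1}(T)\ge\cdots\ge\mathrm{sep}_{k_p}(T)$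 and moreover $\mathrm{sep}_{k_j}(T)>\mathrm{sep}_{k_{j+1}}(T)$ whenever column $k_{j+1}$ contains a box filled with $\{1,2\}$. $\mathrm{flip}(T)$: replace each $\{1\}$ in every 1-pure column by $\{2\}$, each $\{2\}$ in every 2-pure column by $\{1\}$, leave mixed columns unchanged. A column index $k$ is a descent of $T$ if some row $i$ has $(i,k),(i,k+1)\in\lambda/\mu$ with $\max T(i,k)=2$ and $\min T(i,k+1)=1$. For a benign $T$ with descent $k$, exactly one of the following holds and $\mathrm{res}_k(T)$ is defined by changing only columns $k,k+1$: (M1) column $k$ mixed, column $k+1$ 1-pure: let $r=\mathrm{sep}_k(T)$; column $k$ becomes all $\{1\}$, and in column $k+1$ boxes in rows $<r$ get $\{1\}$, the box in row $r$ gets $T(r,k)$, boxes in rows $>r$ get $\{2\}$. (2M) column $k$ 2-pure, column $k+1$ mixed: let $s$ be the largest row with $1\in T(s,k+1)$; column $k+1$ becomes all $\{2\}$, and in column $k$ boxes in rows $<s$ get $\{1\}$, the box in row $s$ gets $T(s,k+1)$, boxes in rows $>s$ get $\{2\}$. (21) column $k$ 2-pure, column $k+1$ 1-pure: column $k$ becomes all $\{1\}$ and column $k+1$ all $\{2\}$. Finally $\ell(T)=\sum_{j\ge1}j\cdot\mathrm{sig}(\text{column }j)$, where $\mathrm{sig}$ is $0$ for an empty or 2-pure column, $1$ for a mixed column and $2$ for a 1-pure column. -}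

module Defs where

open import Data.Nat using (ℕ; zero; suc; _+_; _*_; _∸_; _≤_; _<_; _⊔_; _<ᵇ_; _≤ᵇ_; _≡ᵇ_)
open import Data.Bool using (Bool; true; false; _∧_; _∨_; not; if_then_else_)
open import Data.List using (List; []; _∷_; map; upTo; length; foldr)
open import Data.Bool.ListAction using (any; all)
open import Data.Nat.ListAction using (sum)
open import Data.Product using (_×_; ∃)
open import Relation.Binary.PropositionalEquality using (_≡_; _≢_)

-- Nonempty subsets of {1,2}:  c1 = {1},  c2 = {2},  c12 = {1,2}

data Cell : Set where
  c1 c2 c12 : Cell

cmin : Cell → ℕ
cmin c1  = 1
cmin c2  = 2
cmin c12 = 1

cmax : Cell → ℕ
cmax c1  = 1
cmax c2  = 2
cmax c12 = 2

size : Cell → ℕ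
size c1  = 1
size c2  = 1
size c12 = 2

_∈ᶜ_ : ℕ → Cell → Bool
1 ∈ᶜ c1  = true
1 ∈ᶜ c12 = true
2 ∈ᶜ c2  = true
2 ∈ᶜ c12 = true
_ ∈ᶜ _   = false

is1 : Cell → Bool
is1 c1 = true
is1 _  = false

is2 : Cell → Bool
is2 c2 = true
is2 _  = false

-- Partitions as lists of parts; rows are 1-indexed:
-- part λ i = λ_i for 1 ≤ i ≤ length λ, and 0 otherwise.

part : List ℕ → ℕ → ℕ
part []       _             = 0
part (x ∷ xs) zero          = 0
part (x ∷ xs) (suc zero)    = x
part (x ∷ xs) (suc (suc n)) = part xs (suc n)

IsPartition : List ℕ → Set
IsPartition lam = ∀ i → part lam (suc (suc i)) ≤ part lam (suc i)

_⊆ₚ_ : List ℕ → List ℕ → Set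
mu ⊆ₚ lam = ∀ i → part mu i ≤ part lam i

-- a filling assigns a cell to every position (i , j) = (row , column);
-- only the values on boxes of λ/μ are meaningful.
Filling : Set
Filling = ℕ → ℕ → Cell

range : ℕ → List ℕ
range n = map suc (upTo n)

count : (ℕ → Bool) → List ℕ → ℕ
count p []       = 0
count p (x ∷ xs) = if p x then suc (count p xs) else count p xs

-- first / last element satisfying p (0 if none)
firstWith : (ℕ → Bool) → List ℕ → ℕ
firstWith p []       = 0
firstWith p (x ∷ xs) = if p x then x else firstWith p xs

lastWith : (ℕ → Bool) → List ℕ → ℕ
lastWith p []       = 0
lastWith p (x ∷ xs) = if any p xs then lastWith p xs else (if p x then x else 0)

data Status : Set where
  emptyCol pure1 pure2 mixed : Status

sig : Status → ℕ
sig emptyCol = 0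
sig pure2    = 0
sig mixed    = 1
sig pure1    = 2

module Shape (lam mu : List ℕ) where

  -- box (i , j) ∈ λ/μ  iff  μ_i < j ≤ λ_i  (forces i ≥ 1, j ≥ 1)
  inShapeᵇ : ℕ → ℕ → Bool
  inShapeᵇ i j = (part mu i <ᵇ j) ∧ (j ≤ᵇ part lam i)

  InShape : ℕ → ℕ → Set
  InShape i j = inShapeᵇ i j ≡ true

  -- all boxes lie in rows 1..nRows and columns 1..nCols
  nRows nCols : ℕ
  nRows = length lam
  nCols = foldr _⊔_ 0 lam

  rows cols : List ℕ
  rows = range nRows
  cols = range nCols

  Is12SV : Filling → Set
  Is12SV T = ∀ i j → InShape i j → InShape (suc i) j → cmax (T i j) ≤ cmin (T (suc i) j)

  _≐_ : Filling → Filling → Set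
  T ≐ U = ∀ i j → InShape i j → T i j ≡ U i j

  ircont : Filling → ℕ → ℕ
  ircont T k = count (λ j → any (λ i → inShapeᵇ i j ∧ (k ∈ᶜ T i j)) rows) cols

  ceq : Filling → ℕ → ℕ
  ceq T i = count (λ j → inShapeᵇ i j ∧ inShapeᵇ (suc i) j ∧ (cmax (T i j) ≡ᵇ cmin (T (suc i) j))) cols

  ex : Filling → ℕ → ℕ
  ex T i = sum (map (λ j → if inShapeᵇ i j then size (T i j) ∸ 1 else 0) cols)

  status : Filling → ℕ → Status
  status T j =
    if not (any (λ i → inShapeᵇ i j) rows) then emptyCol
    else if all (λ i → not (inShapeᵇ i j) ∨ is1 (T i j)) rows then pure1
    else if all (λ i → not (inShapeᵇ i j) ∨ is2 (T i j)) rows then pure2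
    else mixed

  sep : Filling → ℕ → ℕ
  sep T k = firstWith (λ r → inShapeᵇ r k ∧ (2 ∈ᶜ T r k)) rows

  lastOne : Filling → ℕ → ℕ
  lastOne T k = lastWith (λ s → inShapeᵇ s k ∧ (1 ∈ᶜ T s k)) rows

  Has12 : Filling → ℕ → Set
  Has12 T j = ∃ λ i → InShape i j × T i j ≡ c12

  Benign : Filling → Set
  Benign T = ∀ j j' → status T j ≡ mixed → status T j' ≡ mixed → j < j' →
             (∀ m → j < m → m < j' → status T m ≢ mixed) →
             (sep T j' ≤ sep T j) × (Has12 T j' → sep T j' < sep T j)

  flip : Filling → Filling
  flip T i j with status T j
  ... | pure1 = if is1 (T i j) then c2 else T i j
  ... | pure2 = if is2 (T i j) then c1 else T i j
  ... | _     = T i j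

  Descent : Filling → ℕ → Set
  Descent T k = ∃ λ i → InShape i k × InShape i (suc k) ×
                cmax (T i k) ≡ 2 × cmin (T i (suc k)) ≡ 1

  -- res_k ; in any case other than (M1), (2M), (21) it is left as T
  res : ℕ → Filling → Filling
  res k T i j with status T k | status T (suc k)
  ... | mixed | pure1 =
        if j ≡ᵇ k then c1
        else if j ≡ᵇ suc k then
          (if i <ᵇ sep T k then c1 else if i ≡ᵇ sep T k then T (sep T k) k else c2)
        else T i j
  ... | pure2 | mixed =
        if j ≡ᵇ suc k then c2
        else if j ≡ᵇ k then
          (if i <ᵇ lastOne T (suc k) then c1
           else if i ≡ᵇ lastOne T (suc k) then T (lastOne T (suc k)) (suc k) else c2)
        else T i j
  ... | pure2 | pure1 =
        if j ≡ᵇ k then c1 else if j ≡ᵇ suc k then c2 else T i j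
  ... | _ | _ = T i j

  ℓ : Filling → ℕ
  ℓ T = sum (map (λ j → j * sig (status T j)) cols)

open Shape public

{-# OPTIONS --safe #-}

-- Every column of a 12-SV table weakly increases, so it is constantly {1}, constantly {2}, or a
-- profile: {1} above some row r, a cell c ∈ {{2}, {1,2}} at r, and {2} below.  At a descent k
-- the columns k, k+1 are (mixed, 1-pure), (2-pure, mixed) or (2-pure, 1-pure): two mixed columns
-- would force both seps onto the descent row and a {1,2} there, against benignity.  In each case
-- res_k exchanges a column C (the profile, or the constant {2}) with a constant column, and the
-- rows where C passes from {1} to {2} lie in both columns, being weakly above (resp. below) the
-- descent row.  So ceq, ex and ircont, sums over columns of a quantity that only depends on the
-- column, are unchanged, while ℓ drops because the column of larger sig moves left.  After flip
-- the two columns form a descent of the mirror kind, and res_k reads the profile back from its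
-- first 2 (sep) or its last 1 (lastOne), which gives flip T.
module Submission where

open import Defs using (Cell; c1; c2; c12; cmin; cmax; size; _∈ᶜ_; is1; is2; part; IsPartition; _⊆ₚ_;
  Filling; range; count; firstWith; lastWith; Status; emptyCol; pure1; pure2; mixed; sig; module Shape)
open import Data.Bool using (Bool; true; false; _∧_; _∨_; not; if_then_else_; T)
open import Data.Bool.ListAction using (any; all; or; and)
open import Data.Bool.Properties using (T-≡; T-∧; ¬-not; ∧-identityʳ; ∧-zeroʳ)
open import Data.Empty using (⊥; ⊥-elim)
open import Data.List using (List; []; _∷_; map; length; foldr)
open import Data.List.Membership.Propositional using (_∈_; find; lose)
open import Data.List.Membership.Propositional.Properties using (∈-map⁺; ∈-upTo⁺)
open import Data.List.Properties using (map-cong; map-cong-local)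
import Data.List.Relation.Unary.All as All
open import Data.List.Relation.Unary.All.Properties using (all⁺; all⁻)
open import Data.List.Relation.Unary.Any using (here; there)
open import Data.List.Relation.Unary.Any.Properties using (any⁺; any⁻)
open import Data.List.Relation.Unary.AllPairs as AllPairs using (AllPairs; _∷_)
import Data.List.Relation.Unary.AllPairs.Properties as AllPairs
open import Data.List.Relation.Unary.Unique.Propositional using (Unique)
import Data.List.Relation.Unary.Unique.Propositional.Properties as Unique
open import Data.Nat using (ℕ; zero; suc; _+_; _*_; _∸_; _≤_; _<_; _⊔_; _<ᵇ_; _≡ᵇ_; z≤n; s≤s; z<s; s<s)
open import Data.Nat.ListAction using (sum)
open import Data.Nat.Tactic.RingSolver using (solve-∀)
open import Data.Nat.Properties
open import Data.Product using (_×_; _,_; ∃; proj₁; proj₂; map₂)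
open import Data.Sum as Sum using (_⊎_; inj₁; inj₂)
open import Function using (_∘_; id; const; Equivalence)
open import Relation.Binary.PropositionalEquality
open import Relation.Nullary using (¬_; yes; no)
open import Relation.Binary.Definitions using (tri<; tri≈; tri>)

open Equivalence using (to; from)

true≢false : true ≢ false
true≢false ()

𝟙 : Bool → ℕ
𝟙 b = if b then 1 else 0

∧≡true⇒ : ∀ {a b} → a ∧ b ≡ true → a ≡ true × b ≡ true
∧≡true⇒ {true} {true} _ = refl , refl

unguarded : ∀ {a b} → not a ∨ b ≡ false → a ≡ true × b ≡ false
unguarded {true} {false} _ = refl , refl

≡ᵇ-refl : ∀ n → (n ≡ᵇ n) ≡ true
≡ᵇ-refl n = to T-≡ (≡⇒≡ᵇ n n refl)

≢⇒≡ᵇ-false : ∀ {m n} → m ≢ n → (m ≡ᵇ n) ≡ false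
≢⇒≡ᵇ-false {m} {n} m≢n = ¬-not (m≢n ∘ ≡ᵇ⇒≡ m n ∘ from T-≡)

𝟙-swap : ∀ a b a′ b′ e → (e ≡ false → (a ≡ true × b ≡ true) × (a′ ≡ true × b′ ≡ true)) →
  𝟙 (a ∧ b ∧ true) + 𝟙 (a′ ∧ b′ ∧ e) ≡ 𝟙 (a ∧ b ∧ e) + 𝟙 (a′ ∧ b′ ∧ true)
𝟙-swap _ _ _ _ true  _ = refl
𝟙-swap _ _ _ _ false all-true with all-true refl
... | (refl , refl) , (refl , refl) = refl

if-swap : ∀ a a′ n → n ≡ 0 ⊎ (a ≡ true × a′ ≡ true) →
  (if a then 0 else 0) + (if a′ then n else 0) ≡ (if a then n else 0) + (if a′ then 0 else 0)
if-swap true  true  _ _                    = +-comm 0 _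
if-swap true  false _ (inj₁ refl)          = refl
if-swap false true  _ (inj₁ refl)          = refl
if-swap false false _ _                    = refl
if-swap true  false _ (inj₂ (_ , ()))
if-swap false true  _ (inj₂ (() , _))

weights-swap : ∀ k {a b} → a < b → k * b + suc k * a < k * a + suc k * b
weights-swap k {a} {b} a<b = begin-strict
    k * b + suc k * a   ≡⟨ regroup k b a ⟩
    k * a + k * b + a   <⟨ +-monoʳ-< (k * a + k * b) a<b ⟩
    k * a + k * b + b   ≡⟨ regroup′ k a b ⟩
    k * a + suc k * b   ∎
  where
    open ≤-Reasoning
    regroup : ∀ k b a → k * b + suc k * a ≡ k * a + k * b + a
    regroup = solve-∀
    regroup′ : ∀ k a b → k * a + k * b + b ≡ k * a + suc k * b
    regroup′ = solve-∀


count≡sum : ∀ (p : ℕ → Bool) xs → count p xs ≡ sum (map (𝟙 ∘ p) xs)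
count≡sum p []       = refl
count≡sum p (x ∷ xs) with p x
... | true  = cong suc (count≡sum p xs)
... | false = count≡sum p xs

module _ {A : Set} (p : A → Bool) where

  any-true : ∀ {x xs} → x ∈ xs → p x ≡ true → any p xs ≡ true
  any-true x∈xs px = to T-≡ (any⁺ p (lose x∈xs (from T-≡ px)))

  any-true⇒ : ∀ xs → any p xs ≡ true → ∃ λ x → x ∈ xs × p x ≡ true
  any-true⇒ xs e with x , x∈xs , px ← find (any⁻ p xs (from T-≡ e)) = x , x∈xs , to T-≡ px

  any-false⇒ : ∀ {x xs} → any p xs ≡ false → x ∈ xs → p x ≡ false
  any-false⇒ e x∈xs = ¬-not λ px → subst T e (from T-≡ (any-true x∈xs px))

  any-false : (∀ x → p x ≡ false) → ∀ xs → any p xs ≡ false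
  any-false p≡false []       = refl
  any-false p≡false (x ∷ xs) rewrite p≡false x = any-false p≡false xs

  all-true⇒ : ∀ {x xs} → all p xs ≡ true → x ∈ xs → p x ≡ true
  all-true⇒ {xs = xs} e x∈xs = to T-≡ (All.lookup (all⁺ p xs (from T-≡ e)) x∈xs)

  all-true : (∀ x → p x ≡ true) → ∀ xs → all p xs ≡ true
  all-true p≡true xs = to T-≡ (all⁻ p (All.universal (λ x → from T-≡ (p≡true x)) xs))

  all-false : ∀ {x xs} → x ∈ xs → p x ≡ false → all p xs ≡ false
  all-false x∈xs px = ¬-not λ e → subst T px (from T-≡ (all-true⇒ e x∈xs))

  all-false⇒ : ∀ xs → all p xs ≡ false → ∃ λ x → p x ≡ false
  all-false⇒ (x ∷ xs) e with p x in px
  ... | true  = all-false⇒ xs e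
  ... | false = x , px

any-cong : ∀ {A : Set} {p q : A → Bool} → (∀ x → p x ≡ q x) → ∀ xs → any p xs ≡ any q xs
any-cong p≗q xs = cong or (map-cong p≗q xs)

all-cong : ∀ {A : Set} {p q : A → Bool} → (∀ x → p x ≡ q x) → ∀ xs → all p xs ≡ all q xs
all-cong p≗q xs = cong and (map-cong p≗q xs)

module _ (p : ℕ → Bool) where

  firstWith-least : ∀ {m xs} → AllPairs _<_ xs → m ∈ xs → p m ≡ true →
    firstWith p xs ∈ xs × p (firstWith p xs) ≡ true ×
    (∀ {y} → y ∈ xs → y < firstWith p xs → p y ≡ false)
  firstWith-least {xs = x ∷ xs} (x< ∷ sorted) m∈ pm with p x in px
  ... | true = here refl , px , least
    where
      least : ∀ {y} → y ∈ x ∷ xs → y < x → p y ≡ false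
      least (here refl)  y<x = ⊥-elim (<-irrefl refl y<x)
      least (there y∈xs) y<x = ⊥-elim (<-asym y<x (All.lookup x< y∈xs))
  ... | false with m∈
  ...   | here refl = ⊥-elim (true≢false (trans (sym pm) px))
  ...   | there m∈xs with firstWith-least sorted m∈xs pm
  ...     | f∈ , pf , least = there f∈ , pf , least′
    where
      least′ : ∀ {y} → y ∈ x ∷ xs → y < firstWith p xs → p y ≡ false
      least′ (here refl)  _ = px
      least′ (there y∈xs) y<f = least y∈xs y<f

  lastWith-greatest : ∀ {m xs} → AllPairs _<_ xs → m ∈ xs → p m ≡ true →
    lastWith p xs ∈ xs × p (lastWith p xs) ≡ true ×
    (∀ {y} → y ∈ xs → lastWith p xs < y → p y ≡ false)
  lastWith-greatest {m} {x ∷ xs} (x< ∷ sorted) m∈ pm with any p xs in any-xs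
  ... | true = lastWith-tail (any-true⇒ p xs any-xs)
    where
      lastWith-tail : (∃ λ m′ → m′ ∈ xs × p m′ ≡ true) →
        lastWith p xs ∈ x ∷ xs × p (lastWith p xs) ≡ true ×
        (∀ {y} → y ∈ x ∷ xs → lastWith p xs < y → p y ≡ false)
      lastWith-tail (_ , m′∈xs , pm′) with l∈ , pl , greatest ← lastWith-greatest sorted m′∈xs pm′ =
        there l∈ , pl , λ { (here refl) l<x → ⊥-elim (<-asym l<x (All.lookup x< l∈))
                          ; (there y∈xs) l<y → greatest y∈xs l<y }
  ... | false with m∈
  ...   | there m∈xs = ⊥-elim (true≢false (trans (sym (any-true p m∈xs pm)) any-xs))
  ...   | here refl rewrite pm = here refl , pm , greatest
    where
      greatest : ∀ {y} → y ∈ m ∷ xs → m < y → p y ≡ false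
      greatest (here refl)  m<m = ⊥-elim (<-irrefl refl m<m)
      greatest (there y∈xs) _   = any-false⇒ p any-xs y∈xs

range-unique : ∀ n → Unique (range n)
range-unique n = Unique.map⁺ suc-injective (Unique.upTo⁺ n)

range-increasing : ∀ n → AllPairs _<_ (range n)
range-increasing n = AllPairs.map⁺ (AllPairs.applyUpTo⁺₁ id n (λ i<j _ → s<s i<j))

∈-range : ∀ {m n} → 1 ≤ m → m ≤ n → m ∈ range n
∈-range {suc m} _ m<n = ∈-map⁺ suc (∈-upTo⁺ m<n)

module _ {f g : ℕ → ℕ} where
  open ≡-Reasoning

  sum-one-point : ∀ {m xs} → Unique xs → m ∈ xs → (∀ {x} → x ∈ xs → x ≢ m → f x ≡ g x) →
    sum (map f xs) + g m ≡ sum (map g xs) + f m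
  sum-one-point {m} {_ ∷ xs} (m∉xs ∷ _) (here refl) f≗g = begin
      f m + sum (map f xs) + g m ≡⟨ cong (λ s → f m + s + g m) rest ⟩
      f m + sum (map g xs) + g m ≡⟨ swap-outer (f m) _ (g m) ⟩
      g m + sum (map g xs) + f m ∎
    where
      swap-outer : ∀ a s b → a + s + b ≡ b + s + a
      swap-outer = solve-∀
      rest : sum (map f xs) ≡ sum (map g xs)
      rest = cong sum (map-cong-local (All.tabulate λ y∈xs → f≗g (there y∈xs) (≢-sym (All.lookup m∉xs y∈xs))))
  sum-one-point {m} {x ∷ xs} (x∉xs ∷ unique) (there m∈xs) f≗g = begin
      f x + sum (map f xs) + g m   ≡⟨ +-assoc (f x) _ _ ⟩
      f x + (sum (map f xs) + g m) ≡⟨ cong₂ _+_ (f≗g (here refl) x≢m)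
                                                (sum-one-point unique m∈xs (f≗g ∘ there)) ⟩
      g x + (sum (map g xs) + f m) ≡⟨ +-assoc (g x) _ _ ⟨
      g x + sum (map g xs) + f m   ∎
    where
      x≢m : x ≢ m
      x≢m = All.lookup x∉xs m∈xs

  sum-head-point : ∀ {x j xs} → Unique (x ∷ xs) → j ∈ xs → (∀ {y} → y ∈ xs → y ≢ j → f y ≡ g y) →
    sum (map f (x ∷ xs)) + (g x + g j) ≡ sum (map g (x ∷ xs)) + (f x + f j)
  sum-head-point {x} {j} {xs} (_ ∷ unique) j∈xs f≗g = begin
      f x + sum (map f xs) + (g x + g j) ≡⟨ interchange (f x) _ (g x) _ ⟩
      f x + g x + (sum (map f xs) + g j) ≡⟨ cong (f x + g x +_) (sum-one-point unique j∈xs f≗g) ⟩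
      f x + g x + (sum (map g xs) + f j) ≡⟨ interchange′ (f x) (g x) _ _ ⟩
      g x + sum (map g xs) + (f x + f j) ∎
    where
      interchange : ∀ a s b c → a + s + (b + c) ≡ a + b + (s + c)
      interchange = solve-∀
      interchange′ : ∀ a b s c → a + b + (s + c) ≡ b + s + (a + c)
      interchange′ = solve-∀

  sum-two-point : ∀ {j j′ xs} → Unique xs → j ≢ j′ → j ∈ xs → j′ ∈ xs →
    (∀ {x} → x ∈ xs → x ≢ j → x ≢ j′ → f x ≡ g x) →
    sum (map f xs) + (g j + g j′) ≡ sum (map g xs) + (f j + f j′)
  sum-two-point (_ ∷ _) j≢j′ (here refl) (here refl) _ = ⊥-elim (j≢j′ refl)
  sum-two-point u@(j∉xs ∷ _) _ (here refl) (there j′∈xs) f≗g =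
    sum-head-point u j′∈xs λ y∈xs → f≗g (there y∈xs) (≢-sym (All.lookup j∉xs y∈xs))
  sum-two-point {j} {j′} {_ ∷ xs} u@(j′∉xs ∷ _) _ (there j∈xs) (here refl) f≗g = begin
      sum (map f (j′ ∷ xs)) + (g j + g j′) ≡⟨ cong (sum (map f (j′ ∷ xs)) +_) (+-comm (g j) (g j′)) ⟩
      sum (map f (j′ ∷ xs)) + (g j′ + g j) ≡⟨ sum-head-point u j∈xs tail ⟩
      sum (map g (j′ ∷ xs)) + (f j′ + f j) ≡⟨ cong (sum (map g (j′ ∷ xs)) +_) (+-comm (f j′) (f j)) ⟩
      sum (map g (j′ ∷ xs)) + (f j + f j′) ∎
    where
      tail : ∀ {y} → y ∈ xs → y ≢ j → f y ≡ g y
      tail y∈xs y≢j = f≗g (there y∈xs) y≢j (≢-sym (All.lookup j′∉xs y∈xs))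
  sum-two-point {j} {j′} {x ∷ xs} (x∉xs ∷ unique) j≢j′ (there j∈xs) (there j′∈xs) f≗g = begin
      f x + sum (map f xs) + (g j + g j′)   ≡⟨ +-assoc (f x) _ _ ⟩
      f x + (sum (map f xs) + (g j + g j′)) ≡⟨ cong₂ _+_ fx≡gx
                                                 (sum-two-point unique j≢j′ j∈xs j′∈xs (f≗g ∘ there)) ⟩
      g x + (sum (map g xs) + (f j + f j′)) ≡⟨ +-assoc (g x) _ _ ⟨
      g x + sum (map g xs) + (f j + f j′)   ∎
    where
      fx≡gx : f x ≡ g x
      fx≡gx = f≗g (here refl) (All.lookup x∉xs j∈xs) (All.lookup x∉xs j′∈xs)

  module _ {j j′ xs} (unique : Unique xs) (j≢j′ : j ≢ j′) (j∈xs : j ∈ xs) (j′∈xs : j′ ∈ xs)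
           (f≗g : ∀ {x} → x ∈ xs → x ≢ j → x ≢ j′ → f x ≡ g x) where

    sum-≡-two-point : f j + f j′ ≡ g j + g j′ → sum (map f xs) ≡ sum (map g xs)
    sum-≡-two-point eq = +-cancelʳ-≡ (g j + g j′) _ _ (begin
      sum (map f xs) + (g j + g j′) ≡⟨ sum-two-point unique j≢j′ j∈xs j′∈xs f≗g ⟩
      sum (map g xs) + (f j + f j′) ≡⟨ cong (sum (map g xs) +_) eq ⟩
      sum (map g xs) + (g j + g j′) ∎)

    sum-<-two-point : f j + f j′ < g j + g j′ → sum (map f xs) < sum (map g xs)
    sum-<-two-point lt = +-cancelʳ-< (g j + g j′) _ _
      (≤-<-trans (≤-reflexive (sum-two-point unique j≢j′ j∈xs j′∈xs f≗g)) (+-monoʳ-< (sum (map g xs)) lt))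


c1≢c2 : c1 ≢ c2
c1≢c2 ()

c12≢c2 : c12 ≢ c2
c12≢c2 ()

≢c1⇒2∈ : ∀ {x} → x ≢ c1 → (2 ∈ᶜ x) ≡ true
≢c1⇒2∈ {c1}  x≢c1 = ⊥-elim (x≢c1 refl)
≢c1⇒2∈ {c2}  _    = refl
≢c1⇒2∈ {c12} _    = refl

2∈⇒≢c1 : ∀ {x} → (2 ∈ᶜ x) ≡ true → x ≢ c1
2∈⇒≢c1 {c1} () refl

2∉⇒≡c1 : ∀ {x} → (2 ∈ᶜ x) ≡ false → x ≡ c1
2∉⇒≡c1 {c1} _ = refl

≢c2⇒1∈ : ∀ {x} → x ≢ c2 → (1 ∈ᶜ x) ≡ true
≢c2⇒1∈ {c1}  _    = refl
≢c2⇒1∈ {c2}  x≢c2 = ⊥-elim (x≢c2 refl)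
≢c2⇒1∈ {c12} _    = refl

1∈⇒≢c2 : ∀ {x} → (1 ∈ᶜ x) ≡ true → x ≢ c2
1∈⇒≢c2 {c2} () refl

1∉⇒≡c2 : ∀ {x} → (1 ∈ᶜ x) ≡ false → x ≡ c2
1∉⇒≡c2 {c2} _ = refl

is1⇒≡c1 : ∀ {x} → is1 x ≡ true → x ≡ c1
is1⇒≡c1 {c1} _ = refl

is2⇒≡c2 : ∀ {x} → is2 x ≡ true → x ≡ c2
is2⇒≡c2 {c2} _ = refl

≢c1⇒¬is1 : ∀ {x} → x ≢ c1 → is1 x ≡ false
≢c1⇒¬is1 {c1}  x≢c1 = ⊥-elim (x≢c1 refl)
≢c1⇒¬is1 {c2}  _    = refl
≢c1⇒¬is1 {c12} _    = refl

≢c2⇒¬is2 : ∀ {x} → x ≢ c2 → is2 x ≡ false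
≢c2⇒¬is2 {c1}  _    = refl
≢c2⇒¬is2 {c2}  x≢c2 = ⊥-elim (x≢c2 refl)
≢c2⇒¬is2 {c12} _    = refl

¬is1⇒≢c1 : ∀ {x} → is1 x ≡ false → x ≢ c1
¬is1⇒≢c1 () refl

¬is2⇒≢c2 : ∀ {x} → is2 x ≡ false → x ≢ c2
¬is2⇒≢c2 () refl

cmax≡2⇒≢c1 : ∀ {x} → cmax x ≡ 2 → x ≢ c1
cmax≡2⇒≢c1 {c1} () refl

cmin≡1⇒≢c2 : ∀ {x} → cmin x ≡ 1 → x ≢ c2
cmin≡1⇒≢c2 {c2} () refl

≢c1⇒cmax≡2 : ∀ {x} → x ≢ c1 → cmax x ≡ 2
≢c1⇒cmax≡2 {c1}  x≢c1 = ⊥-elim (x≢c1 refl)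
≢c1⇒cmax≡2 {c2}  _    = refl
≢c1⇒cmax≡2 {c12} _    = refl

≢c2⇒cmin≡1 : ∀ {x} → x ≢ c2 → cmin x ≡ 1
≢c2⇒cmin≡1 {c1}  _    = refl
≢c2⇒cmin≡1 {c2}  x≢c2 = ⊥-elim (x≢c2 refl)
≢c2⇒cmin≡1 {c12} _    = refl

≢c1∧≢c2⇒≡c12 : ∀ {x} → x ≢ c1 → x ≢ c2 → x ≡ c12
≢c1∧≢c2⇒≡c12 {c1}  x≢c1 _    = ⊥-elim (x≢c1 refl)
≢c1∧≢c2⇒≡c12 {c2}  _    x≢c2 = ⊥-elim (x≢c2 refl)
≢c1∧≢c2⇒≡c12 {c12} _    _    = refl

cmin≤cmax : ∀ x → cmin x ≤ cmax x
cmin≤cmax c1  = ≤-refl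
cmin≤cmax c2  = ≤-refl
cmin≤cmax c12 = s≤s z≤n

cmax≤cmin-≢c1⇒≡c2 : ∀ {x y} → cmax x ≤ cmin y → x ≢ c1 → y ≡ c2
cmax≤cmin-≢c1⇒≡c2 {x} {y} x≤y x≢c1 with y
... | c2  = refl
... | c1  = ⊥-elim (<-irrefl refl (≤-trans (≤-reflexive (sym (≢c1⇒cmax≡2 x≢c1))) x≤y))
... | c12 = ⊥-elim (<-irrefl refl (≤-trans (≤-reflexive (sym (≢c1⇒cmax≡2 x≢c1))) x≤y))

data Singleton : Cell → Set where
  singleton-c1 : Singleton c1
  singleton-c2 : Singleton c2

size∸1≡0⊎≡c12 : ∀ x → size x ∸ 1 ≡ 0 ⊎ x ≡ c12
size∸1≡0⊎≡c12 c1  = inj₁ refl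
size∸1≡0⊎≡c12 c2  = inj₁ refl
size∸1≡0⊎≡c12 c12 = inj₂ refl


-- Profiles

-- Definitionally the column that res writes in the cases (M1) and (2M).
profile : ℕ → Cell → ℕ → Cell
profile r c i = if i <ᵇ r then c1 else if i ≡ᵇ r then c else c2

profile-< : ∀ {r i} c → i < r → profile r c i ≡ c1
profile-< c z<s       = refl
profile-< {suc r} {suc i} c (s<s i<r) = profile-< {r} {i} c i<r

profile-≡ : ∀ r c → profile r c r ≡ c
profile-≡ zero    c = refl
profile-≡ (suc r) c = profile-≡ r c

profile-> : ∀ {r i} c → r < i → profile r c i ≡ c2
profile-> c z<s       = refl
profile-> {suc r} {suc i} c (s<s r<i) = profile-> {r} {i} c r<i

profile-≢c1⇒≤ : ∀ {r c i} → profile r c i ≢ c1 → r ≤ i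
profile-≢c1⇒≤ {c = c} ≢c1 = ≮⇒≥ (≢c1 ∘ profile-< c)

profile-≢c2⇒≤ : ∀ {r c i} → profile r c i ≢ c2 → i ≤ r
profile-≢c2⇒≤ {c = c} ≢c2 = ≮⇒≥ (≢c2 ∘ profile-> c)

profile-c2-≥ : ∀ {r i} → r ≤ i → profile r c2 i ≡ c2
profile-c2-≥ {r} r≤i with m≤n⇒m<n∨m≡n r≤i
... | inj₁ r<i  = profile-> c2 r<i
... | inj₂ refl = profile-≡ r c2

profile-c1≗c2 : ∀ r i → profile r c1 i ≡ profile (suc r) c2 i
profile-c1≗c2 zero    zero          = refl
profile-c1≗c2 zero    (suc zero)    = refl
profile-c1≗c2 zero    (suc (suc i)) = refl
profile-c1≗c2 (suc r) zero          = refl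
profile-c1≗c2 (suc r) (suc i)       = profile-c1≗c2 r i

profile-≡c12 : ∀ {r c i} → profile r c i ≡ c12 → i ≡ r
profile-≡c12 {zero}  {i = zero}  _ = refl
profile-≡c12 {zero}  {i = suc i} ()
profile-≡c12 {suc r} {i = zero}  ()
profile-≡c12 {suc r} {i = suc i} eq = cong suc (profile-≡c12 {r} {i = i} eq)

profile-defect : ∀ r c i → (cmax (profile r c i) ≡ᵇ cmin (profile r c (suc i))) ≡ false →
  (c ≡ c1 × i ≡ r) ⊎ (c ≡ c2 × suc i ≡ r)
profile-defect zero          c1  zero    _  = inj₁ (refl , refl)
profile-defect zero          c2  zero    ()
profile-defect zero          c12 zero    ()
profile-defect zero          c   (suc i) ()
profile-defect (suc zero)    c1  zero    ()
profile-defect (suc zero)    c2  zero    _  = inj₂ (refl , refl)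
profile-defect (suc zero)    c12 zero    ()
profile-defect (suc (suc r)) c   zero    ()
profile-defect (suc r)       c   (suc i) eq =
  Sum.map (map₂ (cong suc)) (map₂ (cong suc)) (profile-defect r c i eq)

-- The rows where profile r c (c ≢ {1}) passes from {1} to {2}; they hold both values, and all
-- ceq defects and all {1,2} cells of the profile lie in them.
data Window (P : ℕ → Set) : ℕ → Cell → Set where
  window-c12 : ∀ {r} → P r → Window P r c12
  window-c2  : ∀ {r} → P r → P (suc r) → Window P (suc r) c2

module _ {P : ℕ → Set} where

  window-at : ∀ {r c} → Window P r c → P r
  window-at (window-c12 pr)  = pr
  window-at (window-c2 _ pr) = pr

  window-≢c1 : ∀ {r c} → Window P r c → c ≢ c1
  window-≢c1 (window-c12 _)  ()
  window-≢c1 (window-c2 _ _) ()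

  window-profile-≢c1 : ∀ {r c} → Window P r c → ∃ λ x → P x × profile r c x ≢ c1
  window-profile-≢c1 {r} {c} w = r , window-at w , λ eq → window-≢c1 w (trans (sym (profile-≡ r c)) eq)

  window-profile-≢c2 : ∀ {r c} → Window P r c → ∃ λ x → P x × profile r c x ≢ c2
  window-profile-≢c2 {r} (window-c12 pr)   = r , pr , λ eq → c12≢c2 (trans (sym (profile-≡ r c12)) eq)
  window-profile-≢c2 (window-c2 {r} pr _) = r , pr , λ eq → c1≢c2 (trans (sym (profile-< c2 (n<1+n r))) eq)

  window-defect : ∀ {r c i} → Window P r c → (cmax (profile r c i) ≡ᵇ cmin (profile r c (suc i))) ≡ false →
    P i × P (suc i)
  window-defect {r} {c} {i} w defect = rows w (profile-defect r c i defect)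
    where
      rows : ∀ {r c} → Window P r c → (c ≡ c1 × i ≡ r) ⊎ (c ≡ c2 × suc i ≡ r) → P i × P (suc i)
      rows w                 (inj₁ (refl , _))   = ⊥-elim (window-≢c1 w refl)
      rows (window-c12 _)     (inj₂ (() , _))
      rows (window-c2 pr psr) (inj₂ (_ , refl))  = pr , psr

  module _ {Q : ℕ → Set} where

    window-map : ∀ {r c} → (∀ {x} → P x → Q x) → Window P r c → Window Q r c
    window-map P⇒Q (window-c12 pr)     = window-c12 (P⇒Q pr)
    window-map P⇒Q (window-c2 pr psr)  = window-c2 (P⇒Q pr) (P⇒Q psr)

    window-map-≤ : ∀ {r c m} → profile r c m ≢ c1 → (∀ {x} → x ≤ m → P x → Q x) →
      Window P r c → Window Q r c
    window-map-≤ ≢c1 P⇒Q (window-c12 pr)    = window-c12 (P⇒Q (profile-≢c1⇒≤ ≢c1) pr)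
    window-map-≤ ≢c1 P⇒Q (window-c2 pr psr) =
      window-c2 (P⇒Q (<⇒≤ (profile-≢c1⇒≤ ≢c1)) pr) (P⇒Q (profile-≢c1⇒≤ ≢c1) psr)

    window-map-≥ : ∀ {r c m} → profile r c m ≢ c2 → (∀ {x} → m ≤ x → P x → Q x) →
      Window P r c → Window Q r c
    window-map-≥ ≢c2 P⇒Q (window-c12 pr)            = window-c12 (P⇒Q (profile-≢c2⇒≤ ≢c2) pr)
    window-map-≥ {m = m} ≢c2 P⇒Q (window-c2 {r} pr psr) =
      window-c2 (P⇒Q m≤r pr) (P⇒Q (m≤n⇒m≤1+n m≤r) psr)
      where
        m≤r : m ≤ r
        m≤r = ≤-pred (≤∧≢⇒< (profile-≢c2⇒≤ ≢c2) λ { refl → ≢c2 (profile-≡ (suc r) c2) })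


-- status X j unfolds to classify applied to three Boolean tests over the rows.
classify : Bool → Bool → Bool → Status
classify nonempty all1 all2 = if not nonempty then emptyCol else if all1 then pure1 else if all2 then pure2 else mixed

classify-pure1⁺ : ∀ {a b c} → a ≡ true → b ≡ true → classify a b c ≡ pure1
classify-pure1⁺ refl refl = refl

classify-pure2⁺ : ∀ {a b c} → a ≡ true → b ≡ false → c ≡ true → classify a b c ≡ pure2
classify-pure2⁺ refl refl refl = refl

classify-mixed⁺ : ∀ {a b c} → a ≡ true → b ≡ false → c ≡ false → classify a b c ≡ mixed
classify-mixed⁺ refl refl refl = refl

classify-emptyCol⁻ : ∀ a b c → classify a b c ≡ emptyCol → a ≡ false
classify-emptyCol⁻ false _ _ _ = refl
classify-emptyCol⁻ true true _ ()
classify-emptyCol⁻ true false true ()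
classify-emptyCol⁻ true false false ()

classify-pure1⁻ : ∀ a b c → classify a b c ≡ pure1 → b ≡ true
classify-pure1⁻ true true _ _ = refl
classify-pure1⁻ false _ _ ()
classify-pure1⁻ true false true ()
classify-pure1⁻ true false false ()

classify-pure2⁻ : ∀ a b c → classify a b c ≡ pure2 → c ≡ true
classify-pure2⁻ true false true _ = refl
classify-pure2⁻ false _ _ ()
classify-pure2⁻ true true _ ()
classify-pure2⁻ true false false ()

classify-mixed⁻ : ∀ a b c → classify a b c ≡ mixed → b ≡ false × c ≡ false
classify-mixed⁻ true false false _ = refl , refl
classify-mixed⁻ false _ _ ()
classify-mixed⁻ true true _ ()
classify-mixed⁻ true false true ()


part-antitone : ∀ l → IsPartition l → ∀ {a b} → 1 ≤ a → a ≤ b → part l b ≤ part l a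
part-antitone l pl {a} {b} 1≤a a≤b with m≤n⇒m<n∨m≡n a≤b
... | inj₂ refl = ≤-refl
part-antitone l pl {suc a} {suc (suc b)} 1≤a _ | inj₁ a<b = ≤-trans (pl b) (part-antitone l pl 1≤a (≤-pred a<b))
part-antitone l pl {suc a} {suc zero}    _   _ | inj₁ (s≤s ())

part-positive : ∀ l i → 0 < part l i → 1 ≤ i × i ≤ length l
part-positive (_ ∷ _)  (suc zero)    _   = s≤s z≤n , s≤s z≤n
part-positive (_ ∷ xs) (suc (suc i)) pos = s≤s z≤n , s≤s (proj₂ (part-positive xs (suc i) pos))

part≤max : ∀ l i → part l i ≤ foldr _⊔_ 0 l
part≤max []       _             = z≤n
part≤max (_ ∷ _)  zero          = z≤n
part≤max (x ∷ xs) (suc zero)    = m≤m⊔n x _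
part≤max (x ∷ xs) (suc (suc i)) = ≤-trans (part≤max xs (suc i)) (m≤n⊔m x _)


module SkewShape (lam mu : List ℕ) (lam-partition : IsPartition lam) (mu-partition : IsPartition mu) where
  open Shape lam mu

  -- Columns of λ/μ

  -- InShape i j unfolds to a Boolean equation, from which i and j cannot be inferred.
  record Box (i j : ℕ) : Set where
    constructor box
    field inShape : InShape i j
  open Box public

  box⇒bounds : ∀ {i j} → Box i j → part mu i < j × j ≤ part lam i
  box⇒bounds {i} {j} (box e) with to T-∧ (from T-≡ e)
  ... | lower , upper = <ᵇ⇒< (part mu i) j lower , ≤ᵇ⇒≤ j (part lam i) upper

  bounds⇒box : ∀ {i j} → part mu i < j → j ≤ part lam i → Box i j
  bounds⇒box lower upper = box (to T-≡ (from T-∧ (<⇒<ᵇ lower , ≤⇒≤ᵇ upper)))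

  box-row-bounds : ∀ {i j} → Box i j → 1 ≤ i × i ≤ nRows
  box-row-bounds {i} b with box⇒bounds b
  ... | lower , upper = part-positive lam i (<-≤-trans (s≤s z≤n) (≤-trans lower upper))

  box∈rows : ∀ {i j} → Box i j → i ∈ rows
  box∈rows b = ∈-range (proj₁ (box-row-bounds b)) (proj₂ (box-row-bounds b))

  box∈cols : ∀ {i j} → Box i j → j ∈ cols
  box∈cols {i} b with box⇒bounds b
  ... | lower , upper = ∈-range (<-≤-trans (s≤s z≤n) lower) (≤-trans upper (part≤max lam i))

  box-between : ∀ {a b c j} → Box a j → Box b j → a ≤ c → c ≤ b → Box c j
  box-between box-a box-b a≤c c≤b = bounds⇒box
    (≤-<-trans (part-antitone mu mu-partition (proj₁ (box-row-bounds box-a)) a≤c) (proj₁ (box⇒bounds box-a)))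
    (≤-trans (proj₂ (box⇒bounds box-b))
             (part-antitone lam lam-partition (≤-trans (proj₁ (box-row-bounds box-a)) a≤c) c≤b))

  box-right : ∀ {a b k} → Box a k → Box b (suc k) → a ≤ b → Box a (suc k)
  box-right box-a box-b a≤b = bounds⇒box
    (m<n⇒m<1+n (proj₁ (box⇒bounds box-a)))
    (≤-trans (proj₂ (box⇒bounds box-b)) (part-antitone lam lam-partition (proj₁ (box-row-bounds box-a)) a≤b))

  box-left : ∀ {a b k} → Box a k → Box b (suc k) → a ≤ b → Box b k
  box-left box-a box-b a≤b = bounds⇒box
    (≤-<-trans (part-antitone mu mu-partition (proj₁ (box-row-bounds box-a)) a≤b) (proj₁ (box⇒bounds box-a)))
    (≤-trans (n≤1+n _) (proj₂ (box⇒bounds box-b)))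

  column : Filling → ℕ → ℕ → Cell
  column X j i = X i j

  infix 4 _≐[_]_
  _≐[_]_ : (ℕ → Cell) → ℕ → (ℕ → Cell) → Set
  C ≐[ j ] D = ∀ {i} → Box i j → C i ≡ D i

  module _ {j : ℕ} where

    guarded-true : (q : ℕ → Bool) → (∀ {i} → Box i j → q i ≡ true) →
      ∀ i → not (inShapeᵇ i j) ∨ q i ≡ true
    guarded-true q q-true i with inShapeᵇ i j in e
    ... | false = refl
    ... | true  = q-true (box e)

    guarded-at : ∀ {i} b → Box i j → not (inShapeᵇ i j) ∨ b ≡ b
    guarded-at _ (box e) rewrite e = refl

    guarded-cong : (q q′ : ℕ → Bool) → (∀ {i} → Box i j → q i ≡ q′ i) →
      ∀ i → not (inShapeᵇ i j) ∨ q i ≡ not (inShapeᵇ i j) ∨ q′ i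
    guarded-cong q q′ q≡q′ i with inShapeᵇ i j in e
    ... | false = refl
    ... | true  = q≡q′ (box e)

    column-nonempty : ∀ {i} → Box i j → any (λ i → inShapeᵇ i j) rows ≡ true
    column-nonempty b = any-true _ (box∈rows b) (inShape b)

  module _ (X : Filling) {j : ℕ} where

    private
      nonempty? all-c1? all-c2? : Bool
      nonempty? = any (λ i → inShapeᵇ i j) rows
      all-c1?   = all (λ i → not (inShapeᵇ i j) ∨ is1 (X i j)) rows
      all-c2?   = all (λ i → not (inShapeᵇ i j) ∨ is2 (X i j)) rows

      status≡classify : status X j ≡ classify nonempty? all-c1? all-c2?
      status≡classify = refl

    status-pure1 : ∀ {i} → Box i j → column X j ≐[ j ] const c1 → status X j ≡ pure1
    status-pure1 b all-c1 = trans status≡classify (classify-pure1⁺ (column-nonempty b)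
      (all-true _ (guarded-true (is1 ∘ column X j) λ b′ → cong is1 (all-c1 b′)) rows))

    status-pure2 : ∀ {i} → Box i j → column X j ≐[ j ] const c2 → status X j ≡ pure2
    status-pure2 b all-c2 = trans status≡classify (classify-pure2⁺ (column-nonempty b)
      (all-false _ (box∈rows b) (trans (guarded-at _ b) (cong is1 (all-c2 b))))
      (all-true _ (guarded-true (is2 ∘ column X j) λ b′ → cong is2 (all-c2 b′)) rows))

    status-mixed : ∀ {a b} → Box a j → X a j ≢ c1 → Box b j → X b j ≢ c2 → status X j ≡ mixed
    status-mixed box-a a≢c1 box-b b≢c2 = trans status≡classify (classify-mixed⁺ (column-nonempty box-a)
      (all-false _ (box∈rows box-a) (trans (guarded-at _ box-a) (≢c1⇒¬is1 a≢c1)))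
      (all-false _ (box∈rows box-b) (trans (guarded-at _ box-b) (≢c2⇒¬is2 b≢c2))))

    emptyCol-no-box : status X j ≡ emptyCol → ∀ {i} → ¬ Box i j
    emptyCol-no-box st b = true≢false (trans (sym (column-nonempty b)) (classify-emptyCol⁻ nonempty? all-c1? all-c2? st))

    pure1-column : status X j ≡ pure1 → column X j ≐[ j ] const c1
    pure1-column st b = is1⇒≡c1 (trans (sym (guarded-at _ b))
      (all-true⇒ _ (classify-pure1⁻ nonempty? all-c1? all-c2? st) (box∈rows b)))

    pure2-column : status X j ≡ pure2 → column X j ≐[ j ] const c2
    pure2-column st b = is2⇒≡c2 (trans (sym (guarded-at _ b))
      (all-true⇒ _ (classify-pure2⁻ nonempty? all-c1? all-c2? st) (box∈rows b)))

    mixed-witnesses : status X j ≡ mixed → (∃ λ a → Box a j × X a j ≢ c1) × (∃ λ b → Box b j × X b j ≢ c2)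
    mixed-witnesses st with classify-mixed⁻ nonempty? all-c1? all-c2? st
    ... | ¬all-c1 , ¬all-c2 with all-false⇒ _ rows ¬all-c1 | all-false⇒ _ rows ¬all-c2
    ...   | a , guard-a | b , guard-b with unguarded guard-a | unguarded guard-b
    ...     | in-a , ¬is1 | in-b , ¬is2 = (a , box in-a , ¬is1⇒≢c1 ¬is1) , (b , box in-b , ¬is2⇒≢c2 ¬is2)

  status-≢c1 : ∀ X {i j} → Box i j → X i j ≢ c1 → status X j ≡ mixed ⊎ status X j ≡ pure2
  status-≢c1 X {j = j} b ≢c1 with status X j in st
  ... | emptyCol = ⊥-elim (emptyCol-no-box X st b)
  ... | pure1    = ⊥-elim (≢c1 (pure1-column X st b))
  ... | pure2    = inj₂ refl
  ... | mixed    = inj₁ refl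

  status-≢c2 : ∀ X {i j} → Box i j → X i j ≢ c2 → status X j ≡ mixed ⊎ status X j ≡ pure1
  status-≢c2 X {j = j} b ≢c2 with status X j in st
  ... | emptyCol = ⊥-elim (emptyCol-no-box X st b)
  ... | pure1    = inj₂ refl
  ... | pure2    = ⊥-elim (≢c2 (pure2-column X st b))
  ... | mixed    = inj₁ refl

  status-cong : ∀ X Y {j} → column X j ≐[ j ] column Y j → status X j ≡ status Y j
  status-cong X Y {j} X≐Y = cong₂ (classify (any (λ i → inShapeᵇ i j) rows))
    (all-cong (guarded-cong (is1 ∘ column X j) (is1 ∘ column Y j) (cong is1 ∘ X≐Y)) rows)
    (all-cong (guarded-cong (is2 ∘ column X j) (is2 ∘ column Y j) (cong is2 ∘ X≐Y)) rows)

  inShape-∧ : ∀ {i j} → Box i j → ∀ b → inShapeᵇ i j ∧ b ≡ b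
  inShape-∧ (box e) _ rewrite e = refl

  module _ (X : Filling) {j : ℕ} where

    sep-spec : ∀ {m} → Box m j → X m j ≢ c1 →
      Box (sep X j) j × X (sep X j) j ≢ c1 × (∀ {i} → Box i j → i < sep X j → X i j ≡ c1)
    sep-spec box-m m≢c1
      with firstWith-least (λ r → inShapeᵇ r j ∧ (2 ∈ᶜ X r j)) (range-increasing nRows) (box∈rows box-m)
             (trans (inShape-∧ box-m _) (≢c1⇒2∈ m≢c1))
    ... | _ , first-has-2 , least with ∧≡true⇒ first-has-2
    ...   | in-shape , 2∈ =
      box in-shape , 2∈⇒≢c1 2∈ ,
      λ b i<sep → 2∉⇒≡c1 (trans (sym (inShape-∧ b _)) (least (box∈rows b) i<sep))

    lastOne-spec : ∀ {m} → Box m j → X m j ≢ c2 →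
      Box (lastOne X j) j × X (lastOne X j) j ≢ c2 × (∀ {i} → Box i j → lastOne X j < i → X i j ≡ c2)
    lastOne-spec box-m m≢c2
      with lastWith-greatest (λ s → inShapeᵇ s j ∧ (1 ∈ᶜ X s j)) (range-increasing nRows) (box∈rows box-m)
             (trans (inShape-∧ box-m _) (≢c2⇒1∈ m≢c2))
    ... | _ , last-has-1 , greatest with ∧≡true⇒ last-has-1
    ...   | in-shape , 1∈ =
      box in-shape , 1∈⇒≢c2 1∈ ,
      λ b last<i → 1∉⇒≡c2 (trans (sym (inShape-∧ b _)) (greatest (box∈rows b) last<i))

    sep-unique : ∀ {r} → Box r j → X r j ≢ c1 → (∀ {i} → Box i j → i < r → X i j ≡ c1) →
      sep X j ≡ r
    sep-unique box-r r≢c1 above with sep-spec box-r r≢c1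
    ... | box-sep , sep≢c1 , above-sep =
      ≤-antisym (≮⇒≥ (r≢c1 ∘ above-sep box-r)) (≮⇒≥ (sep≢c1 ∘ above box-sep))

    lastOne-unique : ∀ {s} → Box s j → X s j ≢ c2 → (∀ {i} → Box i j → s < i → X i j ≡ c2) →
      lastOne X j ≡ s
    lastOne-unique box-s s≢c2 below with lastOne-spec box-s s≢c2
    ... | box-last , last≢c2 , below-last =
      ≤-antisym (≮⇒≥ (last≢c2 ∘ below box-last)) (≮⇒≥ (s≢c2 ∘ below-last box-s))

    module _ (sv : Is12SV X) where

      column-monotone : ∀ {a b} → Box a j → Box b j → a < b → cmax (X a j) ≤ cmin (X b j)
      column-monotone {a} {suc b} box-a box-sb a<sb with m≤n⇒m<n∨m≡n (≤-pred a<sb)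
      ... | inj₂ refl = sv a j (inShape box-a) (inShape box-sb)
      ... | inj₁ a<b  = ≤-trans (column-monotone box-a box-b a<b)
                          (≤-trans (cmin≤cmax (X b j)) (sv b j (inShape box-b) (inShape box-sb)))
        where
          box-b : Box b j
          box-b = box-between box-a box-sb (<⇒≤ a<b) (n≤1+n b)

      monotone-column-profile : ∀ {r} → Box r j → X r j ≢ c1 → (∀ {i} → Box i j → i < r → X i j ≡ c1) →
        column X j ≐[ j ] profile r (X r j)
      monotone-column-profile {r} box-r r≢c1 above {i} box-i with <-cmp i r
      ... | tri< i<r _ _ = trans (above box-i i<r) (sym (profile-< _ i<r))
      ... | tri≈ _ refl _ = sym (profile-≡ r _)
      ... | tri> _ _ r<i = trans (cmax≤cmin-≢c1⇒≡c2 (column-monotone box-r box-i r<i) r≢c1) (sym (profile-> _ r<i))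

    profile-window : ∀ {r c b} → column X j ≐[ j ] profile r c → c ≢ c1 → Box r j → Box b j → X b j ≢ c2 →
      Window (λ x → Box x j) r c
    profile-window {r} {c1}  _ c≢c1 _ _ _ = ⊥-elim (c≢c1 refl)
    profile-window {r} {c12} _ _ box-r _ _ = window-c12 box-r
    profile-window {r} {c2} {b} X≐ _ box-r box-b b≢c2 =
      window-above (≤∧≢⇒< (profile-≢c2⇒≤ Pb≢c2) b≢r) box-r
      where
        Pb≢c2 : profile r c2 b ≢ c2
        Pb≢c2 = b≢c2 ∘ trans (X≐ box-b)
        b≢r : b ≢ r
        b≢r refl = Pb≢c2 (profile-≡ b c2)
        window-above : ∀ {r′} → b < r′ → Box r′ j → Window (λ x → Box x j) r′ c2
        window-above (s≤s b≤r′) box-r′ = window-c2 (box-between box-b box-r′ b≤r′ (n≤1+n _)) box-r′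

  module _ (X : Filling) {j : ℕ} where

    mixed-column-profile : Is12SV X → status X j ≡ mixed →
      column X j ≐[ j ] profile (sep X j) (X (sep X j) j) × Window (λ x → Box x j) (sep X j) (X (sep X j) j)
    mixed-column-profile sv st with mixed-witnesses X st
    ... | (a , box-a , a≢c1) , (b , box-b , b≢c2) with sep-spec X box-a a≢c1
    ...   | box-sep , sep≢c1 , above = X≐P , profile-window X X≐P sep≢c1 box-sep box-b b≢c2
      where
        X≐P : column X j ≐[ j ] profile (sep X j) (X (sep X j) j)
        X≐P = monotone-column-profile X sv box-sep sep≢c1 above

    sep-of-profile : ∀ {r c} → column X j ≐[ j ] profile r c → Window (λ x → Box x j) r c →
      ∀ i → profile (sep X j) (X (sep X j) j) i ≡ profile r c i
    sep-of-profile {r} {c} X≐P w i = begin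
        profile (sep X j) (X (sep X j) j) i ≡⟨ cong (λ s → profile s (X s j) i) (sep-unique X box-r r≢c1 above) ⟩
        profile r (X r j) i                 ≡⟨ cong (λ x → profile r x i) Xr≡c ⟩
        profile r c i                       ∎
      where
        open ≡-Reasoning
        box-r : Box r j
        box-r = window-at w
        Xr≡c : X r j ≡ c
        Xr≡c = trans (X≐P box-r) (profile-≡ r c)
        r≢c1 : X r j ≢ c1
        r≢c1 = window-≢c1 w ∘ trans (sym Xr≡c)
        above : ∀ {i} → Box i j → i < r → X i j ≡ c1
        above b i<r = trans (X≐P b) (profile-< c i<r)

    lastOne-of-profile : ∀ {r c} → column X j ≐[ j ] profile r c → Window (λ x → Box x j) r c →
      ∀ i → profile (lastOne X j) (X (lastOne X j) j) i ≡ profile r c i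
    lastOne-of-profile {r} X≐P (window-c12 box-r) i = begin
        profile (lastOne X j) (X (lastOne X j) j) i
          ≡⟨ cong (λ s → profile s (X s j) i) (lastOne-unique X box-r r≢c2 below) ⟩
        profile r (X r j) i                         ≡⟨ cong (λ x → profile r x i) Xr≡c12 ⟩
        profile r c12 i                             ∎
      where
        open ≡-Reasoning
        Xr≡c12 : X r j ≡ c12
        Xr≡c12 = trans (X≐P box-r) (profile-≡ r c12)
        r≢c2 : X r j ≢ c2
        r≢c2 = c12≢c2 ∘ trans (sym Xr≡c12)
        below : ∀ {i} → Box i j → r < i → X i j ≡ c2
        below b r<i = trans (X≐P b) (profile-> c12 r<i)
    lastOne-of-profile X≐P (window-c2 {r} box-r _) i = begin
        profile (lastOne X j) (X (lastOne X j) j) i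
          ≡⟨ cong (λ s → profile s (X s j) i) (lastOne-unique X box-r r≢c2 below) ⟩
        profile r (X r j) i                         ≡⟨ cong (λ x → profile r x i) Xr≡c1 ⟩
        profile r c1 i                              ≡⟨ profile-c1≗c2 r i ⟩
        profile (suc r) c2 i                        ∎
      where
        open ≡-Reasoning
        Xr≡c1 : X r j ≡ c1
        Xr≡c1 = trans (X≐P box-r) (profile-< c2 (n<1+n r))
        r≢c2 : X r j ≢ c2
        r≢c2 = c1≢c2 ∘ trans (sym Xr≡c1)
        below : ∀ {i} → Box i j → r < i → X i j ≡ c2
        below b r<i = trans (X≐P b) (profile-c2-≥ r<i)

  window-mixed : ∀ X {j r c} → column X j ≐[ j ] profile r c → Window (λ x → Box x j) r c → status X j ≡ mixed
  window-mixed X X≐P w with window-profile-≢c1 w | window-profile-≢c2 w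
  ... | a , box-a , a≢c1 | b , box-b , b≢c2 =
    status-mixed X box-a (a≢c1 ∘ trans (sym (X≐P box-a))) box-b (b≢c2 ∘ trans (sym (X≐P box-b)))

  OffColumns : ℕ → ℕ → Filling → Filling → Set
  OffColumns j j′ X Y = ∀ {x} → x ≢ j → x ≢ j′ → column X x ≐[ x ] column Y x

  module _ (k : ℕ) (X : Filling) where

    res-off : OffColumns k (suc k) (res k X) X
    res-off {x} x≢k x≢sk {i} _ with status X k | status X (suc k)
    ... | mixed    | pure1    rewrite ≢⇒≡ᵇ-false x≢k | ≢⇒≡ᵇ-false x≢sk = refl
    ... | pure2    | mixed    rewrite ≢⇒≡ᵇ-false x≢sk | ≢⇒≡ᵇ-false x≢k = refl
    ... | pure2    | pure1    rewrite ≢⇒≡ᵇ-false x≢k | ≢⇒≡ᵇ-false x≢sk = refl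
    ... | emptyCol | _        = refl
    ... | pure1    | _        = refl
    ... | mixed    | emptyCol = refl
    ... | mixed    | pure2    = refl
    ... | mixed    | mixed    = refl
    ... | pure2    | emptyCol = refl
    ... | pure2    | pure2    = refl

    res-M1 : status X k ≡ mixed → status X (suc k) ≡ pure1 →
      (∀ i → res k X i k ≡ c1) × (∀ i → res k X i (suc k) ≡ profile (sep X k) (X (sep X k) k) i)
    res-M1 st-k st-sk = (λ i → lhs i) , λ i → rhs i
      where
        lhs : ∀ i → res k X i k ≡ c1
        lhs i rewrite st-k | st-sk | ≡ᵇ-refl k = refl
        rhs : ∀ i → res k X i (suc k) ≡ profile (sep X k) (X (sep X k) k) i
        rhs i rewrite st-k | st-sk | ≡ᵇ-refl k | ≢⇒≡ᵇ-false (1+n≢n {k}) = refl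

    res-2M : status X k ≡ pure2 → status X (suc k) ≡ mixed →
      (∀ i → res k X i k ≡ profile (lastOne X (suc k)) (X (lastOne X (suc k)) (suc k)) i) ×
      (∀ i → res k X i (suc k) ≡ c2)
    res-2M st-k st-sk = (λ i → lhs i) , λ i → rhs i
      where
        lhs : ∀ i → res k X i k ≡ profile (lastOne X (suc k)) (X (lastOne X (suc k)) (suc k)) i
        lhs i rewrite st-k | st-sk | ≡ᵇ-refl k | ≢⇒≡ᵇ-false (≢-sym (1+n≢n {k})) = refl
        rhs : ∀ i → res k X i (suc k) ≡ c2
        rhs i rewrite st-k | st-sk | ≡ᵇ-refl k = refl

    res-21 : status X k ≡ pure2 → status X (suc k) ≡ pure1 →
      (∀ i → res k X i k ≡ c1) × (∀ i → res k X i (suc k) ≡ c2)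
    res-21 st-k st-sk = (λ i → lhs i) , λ i → rhs i
      where
        lhs : ∀ i → res k X i k ≡ c1
        lhs i rewrite st-k | st-sk | ≡ᵇ-refl k = refl
        rhs : ∀ i → res k X i (suc k) ≡ c2
        rhs i rewrite st-k | st-sk | ≡ᵇ-refl k | ≢⇒≡ᵇ-false (1+n≢n {k}) = refl

  module _ (X : Filling) {j : ℕ} where

    flip-mixed : status X j ≡ mixed → ∀ i → flip X i j ≡ X i j
    flip-mixed st i rewrite st = refl

    flip-pure1 : status X j ≡ pure1 → column (flip X) j ≐[ j ] const c2
    flip-pure1 st b rewrite st | pure1-column X st b = refl

    flip-pure2 : status X j ≡ pure2 → column (flip X) j ≐[ j ] const c1
    flip-pure2 st b rewrite st | pure2-column X st b = refl

  flip-cong : ∀ X Y {i j} → status X j ≡ status Y j → X i j ≡ Y i j → flip X i j ≡ flip Y i j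
  flip-cong X Y {i} {j} st-eq eq with status X j | status Y j
  ... | emptyCol | emptyCol = eq
  ... | pure1    | pure1    rewrite eq = refl
  ... | pure2    | pure2    rewrite eq = refl
  ... | mixed    | mixed    = eq

  flip-off : ∀ {j j′ X Y} → OffColumns j j′ X Y → OffColumns j j′ (flip X) (flip Y)
  flip-off {X = X} {Y} X≐Y x≢j x≢j′ b = flip-cong X Y (status-cong X Y (X≐Y x≢j x≢j′)) (X≐Y x≢j x≢j′ b)

  -- Column statistics

  ceqCol : ℕ → (ℕ → Cell) → ℕ → ℕ
  ceqCol j C i = 𝟙 (inShapeᵇ i j ∧ inShapeᵇ (suc i) j ∧ (cmax (C i) ≡ᵇ cmin (C (suc i))))

  exCol : ℕ → (ℕ → Cell) → ℕ → ℕ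
  exCol j C i = if inShapeᵇ i j then size (C i) ∸ 1 else 0

  irCol : ℕ → (ℕ → Cell) → ℕ → ℕ
  irCol j C r = 𝟙 (any (λ i → inShapeᵇ i j ∧ (r ∈ᶜ C i)) rows)

  ColumnStatistic : Set
  ColumnStatistic = ℕ → (ℕ → Cell) → ℕ

  Local : ColumnStatistic → Set
  Local st = ∀ {j C D} → C ≐[ j ] D → st j C ≡ st j D

  total : ColumnStatistic → Filling → ℕ
  total st X = sum (map (λ j → st j (column X j)) cols)

  ceq≡total : ∀ X i → ceq X i ≡ total (λ j C → ceqCol j C i) X
  ceq≡total X i = count≡sum _ cols

  ircont≡total : ∀ X r → ircont X r ≡ total (λ j C → irCol j C r) X
  ircont≡total X r = count≡sum _ cols

  ceqCol-local : ∀ i → Local (λ j C → ceqCol j C i)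
  ceqCol-local i {j} C≐D with inShapeᵇ i j in e | inShapeᵇ (suc i) j in e′
  ... | true  | true  rewrite C≐D (box e) | C≐D (box e′) = refl
  ... | true  | false = refl
  ... | false | _     = refl

  exCol-local : ∀ i → Local (λ j C → exCol j C i)
  exCol-local i {j} C≐D with inShapeᵇ i j in e
  ... | true  rewrite C≐D (box e) = refl
  ... | false = refl

  irCol-local : ∀ r → Local (λ j C → irCol j C r)
  irCol-local r {j} {C} {D} C≐D = cong 𝟙 (any-cong pointwise rows)
    where
      pointwise : ∀ i → inShapeᵇ i j ∧ (r ∈ᶜ C i) ≡ inShapeᵇ i j ∧ (r ∈ᶜ D i)
      pointwise i with inShapeᵇ i j in e
      ... | true  = cong (r ∈ᶜ_) (C≐D (box e))
      ... | false = refl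

  irCol-const : ∀ {a j} → Box a j → ∀ K r → irCol j (const K) r ≡ 𝟙 (r ∈ᶜ K)
  irCol-const {j = j} b K r with r ∈ᶜ K
  ... | true  = cong 𝟙 (trans (any-cong (λ i → ∧-identityʳ (inShapeᵇ i j)) rows) (column-nonempty b))
  ... | false = cong 𝟙 (any-false _ (λ i → ∧-zeroʳ (inShapeᵇ i j)) rows)

  irCol-mixed : ∀ {a b j} C → Box a j → C a ≢ c1 → Box b j → C b ≢ c2 →
    ∀ r → irCol j C r ≡ 𝟙 (r ∈ᶜ c12)
  irCol-mixed {j = j} C _ _ _ _ zero = cong 𝟙 (any-false _ (λ i → ∧-zeroʳ (inShapeᵇ i j)) rows)
  irCol-mixed C _ _ box-b b≢c2 1 =
    cong 𝟙 (any-true _ (box∈rows box-b) (trans (inShape-∧ box-b _) (≢c2⇒1∈ b≢c2)))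
  irCol-mixed C box-a a≢c1 _ _ 2 =
    cong 𝟙 (any-true _ (box∈rows box-a) (trans (inShape-∧ box-a _) (≢c1⇒2∈ a≢c1)))
  irCol-mixed {j = j} C _ _ _ _ (suc (suc (suc r))) = cong 𝟙 (any-false _ (λ i → ∧-zeroʳ (inShapeᵇ i j)) rows)

  -- What lets C trade places with a constant column between columns j and j′ without changing
  -- ceq, ex and ircont.
  record Exchangeable (j j′ : ℕ) (C : ℕ → Cell) : Set where
    field
      defects-in-both : ∀ {i} → (cmax (C i) ≡ᵇ cmin (C (suc i))) ≡ false →
        (Box i j × Box (suc i) j) × (Box i j′ × Box (suc i) j′)
      excess-in-both : ∀ {i} → C i ≡ c12 → Box i j × Box i j′
      same-content : ∀ r → irCol j C r ≡ irCol j′ C r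

  module _ {j j′ C} (exch : Exchangeable j j′ C) where
    open Exchangeable exch

    private
      defect-in-shape : ∀ {i} → (cmax (C i) ≡ᵇ cmin (C (suc i))) ≡ false →
        (inShapeᵇ i j ≡ true × inShapeᵇ (suc i) j ≡ true) ×
        (inShapeᵇ i j′ ≡ true × inShapeᵇ (suc i) j′ ≡ true)
      defect-in-shape defect with defects-in-both defect
      ... | (b₁ , b₂) , (b₃ , b₄) = (inShape b₁ , inShape b₂) , (inShape b₃ , inShape b₄)

      excess-in-shape : ∀ i → size (C i) ∸ 1 ≡ 0 ⊎ (inShapeᵇ i j ≡ true × inShapeᵇ i j′ ≡ true)
      excess-in-shape i with size∸1≡0⊎≡c12 (C i)
      ... | inj₁ no-excess = inj₁ no-excess
      ... | inj₂ Ci≡c12 with excess-in-both Ci≡c12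
      ...   | b , b′ = inj₂ (inShape b , inShape b′)

    ceqCol-swap : ∀ {K} → Singleton K →
      ∀ i → ceqCol j (const K) i + ceqCol j′ C i ≡ ceqCol j C i + ceqCol j′ (const K) i
    ceqCol-swap singleton-c1 i =
      𝟙-swap (inShapeᵇ i j) (inShapeᵇ (suc i) j) (inShapeᵇ i j′) (inShapeᵇ (suc i) j′) _ defect-in-shape
    ceqCol-swap singleton-c2 i =
      𝟙-swap (inShapeᵇ i j) (inShapeᵇ (suc i) j) (inShapeᵇ i j′) (inShapeᵇ (suc i) j′) _ defect-in-shape

    exCol-swap : ∀ {K} → Singleton K →
      ∀ i → exCol j (const K) i + exCol j′ C i ≡ exCol j C i + exCol j′ (const K) i
    exCol-swap singleton-c1 i = if-swap (inShapeᵇ i j) (inShapeᵇ i j′) _ (excess-in-shape i)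
    exCol-swap singleton-c2 i = if-swap (inShapeᵇ i j) (inShapeᵇ i j′) _ (excess-in-shape i)

    irCol-swap : ∀ {a b} K → Box a j → Box b j′ →
      ∀ r → irCol j (const K) r + irCol j′ C r ≡ irCol j C r + irCol j′ (const K) r
    irCol-swap K box-a box-b r = begin
        irCol j (const K) r + irCol j′ C r ≡⟨ cong₂ _+_ (irCol-const box-a K r) (sym (same-content r)) ⟩
        𝟙 (r ∈ᶜ K) + irCol j C r           ≡⟨ +-comm (𝟙 (r ∈ᶜ K)) _ ⟩
        irCol j C r + 𝟙 (r ∈ᶜ K)           ≡⟨ cong (irCol j C r +_) (irCol-const box-b K r) ⟨
        irCol j C r + irCol j′ (const K) r ∎
      where open ≡-Reasoning

  window-exchangeable : ∀ {j j′ r c} → Window (λ x → Box x j × Box x j′) r c → Exchangeable j j′ (profile r c)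
  window-exchangeable {j} {j′} {r} {c} w = record
    { defects-in-both = defects
    ; excess-in-both  = λ eq → subst (λ x → Box x j × Box x j′) (sym (profile-≡c12 eq)) (window-at w)
    ; same-content    = λ r′ → trans (content (window-map proj₁ w) r′) (sym (content (window-map proj₂ w) r′))
    }
    where
      defects : ∀ {i} → (cmax (profile r c i) ≡ᵇ cmin (profile r c (suc i))) ≡ false →
        (Box i j × Box (suc i) j) × (Box i j′ × Box (suc i) j′)
      defects defect with window-defect w defect
      ... | (b₁ , b₃) , (b₂ , b₄) = (b₁ , b₂) , (b₃ , b₄)
      content : ∀ {j″} → Window (λ x → Box x j″) r c →
        ∀ r′ → irCol j″ (profile r c) r′ ≡ 𝟙 (r′ ∈ᶜ c12)
      content w′ with window-profile-≢c1 w′ | window-profile-≢c2 w′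
      ... | a , box-a , a≢c1 | b , box-b , b≢c2 = irCol-mixed (profile r c) box-a a≢c1 box-b b≢c2

  constant-exchangeable : ∀ {j j′ a b K} → Box a j → Box b j′ → Singleton K → Exchangeable j j′ (const K)
  constant-exchangeable {K = K} box-a box-b single = record
    { defects-in-both = λ defect → ⊥-elim (true≢false (trans (sym (no-defect single)) defect))
    ; excess-in-both  = λ K≡c12 → ⊥-elim (not-c12 single K≡c12)
    ; same-content    = λ r → trans (irCol-const box-a K r) (sym (irCol-const box-b K r))
    }
    where
      no-defect : ∀ {K} → Singleton K → (cmax K ≡ᵇ cmin K) ≡ true
      no-defect singleton-c1 = refl
      no-defect singleton-c2 = refl
      not-c12 : ∀ {K} → Singleton K → K ≢ c12
      not-c12 singleton-c1 ()
      not-c12 singleton-c2 ()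

  record ColumnSwap (X Y : Filling) (j j′ : ℕ) (C : ℕ → Cell) (K : Cell) : Set where
    field
      distinct  : j ≢ j′
      shared    : ∃ λ i → Box i j × Box i j′
      X-j       : column X j ≐[ j ] C
      X-j′      : column X j′ ≐[ j′ ] const K
      Y-j       : column Y j ≐[ j ] const K
      Y-j′      : column Y j′ ≐[ j′ ] C
      elsewhere : OffColumns j j′ Y X

  module _ {X Y j j′ C K} (sw : ColumnSwap X Y j j′ C K) where
    open ColumnSwap sw

    total-swap : ∀ {st} → Local st → st j (const K) + st j′ C ≡ st j C + st j′ (const K) →
      total st Y ≡ total st X
    total-swap {st} local swap = sum-≡-two-point (range-unique nCols) distinct
        (box∈cols (proj₁ (proj₂ shared))) (box∈cols (proj₂ (proj₂ shared)))
        (λ _ x≢j x≢j′ → local (elsewhere x≢j x≢j′)) (begin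
          st j (column Y j) + st j′ (column Y j′) ≡⟨ cong₂ _+_ (local Y-j) (local Y-j′) ⟩
          st j (const K) + st j′ C                ≡⟨ swap ⟩
          st j C + st j′ (const K)                ≡⟨ cong₂ _+_ (local X-j) (local X-j′) ⟨
          st j (column X j) + st j′ (column X j′) ∎)
      where open ≡-Reasoning

    swap-statistics : Singleton K → Exchangeable j j′ C →
      (∀ i → ceq Y i ≡ ceq X i) × (∀ i → ex Y i ≡ ex X i) × (∀ r → ircont Y r ≡ ircont X r)
    swap-statistics single exch =
        (λ i → trans (ceq≡total Y i)
                 (trans (total-swap (ceqCol-local i) (ceqCol-swap exch single i)) (sym (ceq≡total X i))))
      , (λ i → total-swap (exCol-local i) (exCol-swap exch single i))
      , (λ r → trans (ircont≡total Y r)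
                 (trans (total-swap (irCol-local r) (irCol-swap exch K box-j box-j′ r)) (sym (ircont≡total X r))))
      where
        box-j : Box (proj₁ shared) j
        box-j = proj₁ (proj₂ shared)
        box-j′ : Box (proj₁ shared) j′
        box-j′ = proj₂ (proj₂ shared)

  ℓ-swap : ∀ {X Y k i s s′} → Box i k → Box i (suc k) → OffColumns k (suc k) Y X →
    status X k ≡ s → status X (suc k) ≡ s′ → status Y k ≡ s′ → status Y (suc k) ≡ s →
    sig s < sig s′ → ℓ Y < ℓ X
  ℓ-swap {X} {Y} {k} {s = s} {s′} box-k box-sk elsewhere Xk Xsk Yk Ysk sig< =
    sum-<-two-point (range-unique nCols) (≢-sym 1+n≢n) (box∈cols box-k) (box∈cols box-sk)
      (λ {x} _ x≢k x≢sk → cong (λ st → x * sig st) (status-cong Y X (elsewhere x≢k x≢sk)))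
      (begin-strict
        k * sig (status Y k) + suc k * sig (status Y (suc k)) ≡⟨ cong₂ (λ a b → k * sig a + suc k * sig b) Yk Ysk ⟩
        k * sig s′ + suc k * sig s                             <⟨ weights-swap k sig< ⟩
        k * sig s + suc k * sig s′                             ≡⟨ cong₂ (λ a b → k * sig a + suc k * sig b) Xk Xsk ⟨
        k * sig (status X k) + suc k * sig (status X (suc k)) ∎)
    where open ≤-Reasoning

  res-flip-res≐flip : ∀ {k T} → column (res k (flip (res k T))) k ≐[ k ] column (flip T) k →
    column (res k (flip (res k T))) (suc k) ≐[ suc k ] column (flip T) (suc k) → res k (flip (res k T)) ≐ flip T
  res-flip-res≐flip {k} {T} on-k on-sk i j in-shape with j ≟ k | j ≟ suc k
  ... | yes refl | _        = on-k (box in-shape)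
  ... | no _     | yes refl = on-sk (box in-shape)
  ... | no j≢k   | no j≢sk  =
    trans (res-off k (flip (res k T)) j≢k j≢sk (box in-shape)) (flip-off (res-off k T) j≢k j≢sk (box in-shape))

  ResProperties : Filling → ℕ → Set
  ResProperties T k =
    ((∀ i → ceq (res k T) i ≡ ceq T i) × (∀ i → ex (res k T) i ≡ ex T i)
      × (∀ r → ircont (res k T) r ≡ ircont T r))
    × (Descent (flip (res k T)) k × res k (flip (res k T)) ≐ flip T)
    × ℓ (res k T) < ℓ T

  -- The three kinds of descent

  module CaseM1 {T k i₀} (sv : Is12SV T) (box-k : Box i₀ k) (box-sk : Box i₀ (suc k))
                (i₀≢c1 : T i₀ k ≢ c1)
                (mixed-k : status T k ≡ mixed) (pure1-sk : status T (suc k) ≡ pure1) where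
    open ≡-Reasoning

    r : ℕ
    r = sep T k

    P : ℕ → Cell
    P = profile r (T r k)

    T-k : column T k ≐[ k ] P
    T-k = proj₁ (mixed-column-profile T sv mixed-k)

    window : Window (λ x → Box x k × Box x (suc k)) r (T r k)
    window = window-map-≤ (i₀≢c1 ∘ trans (T-k box-k)) (λ x≤i₀ box-x → box-x , box-right box-x box-sk x≤i₀)
               (proj₂ (mixed-column-profile T sv mixed-k))

    U : Filling
    U = res k T

    U-k : ∀ i → U i k ≡ c1
    U-k = proj₁ (res-M1 k T mixed-k pure1-sk)

    U-sk : ∀ i → U i (suc k) ≡ P i
    U-sk = proj₂ (res-M1 k T mixed-k pure1-sk)

    swap : ColumnSwap T U k (suc k) P c1
    swap = record
      { distinct = ≢-sym 1+n≢n ; shared = i₀ , box-k , box-sk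
      ; X-j = T-k ; X-j′ = pure1-column T pure1-sk
      ; Y-j = λ _ → U-k _ ; Y-j′ = λ _ → U-sk _ ; elsewhere = res-off k T }

    U-k-pure1 : status U k ≡ pure1
    U-k-pure1 = status-pure1 U box-k (λ _ → U-k _)

    U-sk-mixed : status U (suc k) ≡ mixed
    U-sk-mixed = window-mixed U (λ _ → U-sk _) (window-map proj₂ window)

    V : Filling
    V = flip U

    V-k : column V k ≐[ k ] const c2
    V-k = flip-pure1 U U-k-pure1

    V-sk : ∀ i → V i (suc k) ≡ P i
    V-sk i = trans (flip-mixed U U-sk-mixed i) (U-sk i)

    V-descent : Descent V k
    V-descent with window-profile-≢c2 window
    ... | w , (box-w , box-sw) , Pw≢c2 =
      w , inShape box-w , inShape box-sw , cong cmax (V-k box-w) , trans (cong cmin (V-sk w)) (≢c2⇒cmin≡1 Pw≢c2)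

    V-k-pure2 : status V k ≡ pure2
    V-k-pure2 = status-pure2 V box-k V-k

    V-sk-mixed : status V (suc k) ≡ mixed
    V-sk-mixed = trans (status-cong V U (λ _ → flip-mixed U U-sk-mixed _)) U-sk-mixed

    round-trip-k : column (res k V) k ≐[ k ] column (flip T) k
    round-trip-k {i} b = begin
      res k V i k                                                   ≡⟨ proj₁ (res-2M k V V-k-pure2 V-sk-mixed) i ⟩
      profile (lastOne V (suc k)) (V (lastOne V (suc k)) (suc k)) i
        ≡⟨ lastOne-of-profile V (λ _ → V-sk _) (window-map proj₂ window) i ⟩
      P i                                                           ≡⟨ T-k b ⟨
      T i k                                                         ≡⟨ flip-mixed T mixed-k i ⟨
      flip T i k                                                    ∎

    round-trip-sk : column (res k V) (suc k) ≐[ suc k ] column (flip T) (suc k)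
    round-trip-sk {i} b = trans (proj₂ (res-2M k V V-k-pure2 V-sk-mixed) i) (sym (flip-pure1 T pure1-sk b))

    properties : ResProperties T k
    properties =
        swap-statistics swap singleton-c1 (window-exchangeable window)
      , (V-descent , res-flip-res≐flip round-trip-k round-trip-sk)
      , ℓ-swap box-k box-sk (res-off k T) mixed-k pure1-sk U-k-pure1 U-sk-mixed (n<1+n 1)

  module Case2M {T k i₀} (sv : Is12SV T) (box-k : Box i₀ k) (box-sk : Box i₀ (suc k))
                (i₀≢c2 : T i₀ (suc k) ≢ c2)
                (pure2-k : status T k ≡ pure2) (mixed-sk : status T (suc k) ≡ mixed) where
    open ≡-Reasoning

    r : ℕ
    r = sep T (suc k)

    P : ℕ → Cell
    P = profile r (T r (suc k))

    T-sk : column T (suc k) ≐[ suc k ] P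
    T-sk = proj₁ (mixed-column-profile T sv mixed-sk)

    window-sk : Window (λ x → Box x (suc k)) r (T r (suc k))
    window-sk = proj₂ (mixed-column-profile T sv mixed-sk)

    window : Window (λ x → Box x (suc k) × Box x k) r (T r (suc k))
    window = window-map-≥ (i₀≢c2 ∘ trans (T-sk box-sk)) (λ i₀≤x box-x → box-x , box-left box-k box-x i₀≤x)
               window-sk

    U : Filling
    U = res k T

    U-k : ∀ i → U i k ≡ P i
    U-k i = trans (proj₁ (res-2M k T pure2-k mixed-sk) i) (lastOne-of-profile T T-sk window-sk i)

    U-sk : ∀ i → U i (suc k) ≡ c2
    U-sk = proj₂ (res-2M k T pure2-k mixed-sk)

    swap : ColumnSwap T U (suc k) k P c2
    swap = record
      { distinct = 1+n≢n ; shared = i₀ , box-sk , box-k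
      ; X-j = T-sk ; X-j′ = pure2-column T pure2-k
      ; Y-j = λ _ → U-sk _ ; Y-j′ = λ _ → U-k _ ; elsewhere = λ x≢sk x≢k → res-off k T x≢k x≢sk }

    U-k-mixed : status U k ≡ mixed
    U-k-mixed = window-mixed U (λ _ → U-k _) (window-map proj₂ window)

    U-sk-pure2 : status U (suc k) ≡ pure2
    U-sk-pure2 = status-pure2 U box-sk (λ _ → U-sk _)

    V : Filling
    V = flip U

    V-k : ∀ i → V i k ≡ P i
    V-k i = trans (flip-mixed U U-k-mixed i) (U-k i)

    V-sk : column V (suc k) ≐[ suc k ] const c1
    V-sk = flip-pure2 U U-sk-pure2

    V-descent : Descent V k
    V-descent with window-profile-≢c1 window
    ... | w , (box-sw , box-w) , Pw≢c1 =
      w , inShape box-w , inShape box-sw , trans (cong cmax (V-k w)) (≢c1⇒cmax≡2 Pw≢c1) , cong cmin (V-sk box-sw)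

    V-k-mixed : status V k ≡ mixed
    V-k-mixed = trans (status-cong V U (λ _ → flip-mixed U U-k-mixed _)) U-k-mixed

    V-sk-pure1 : status V (suc k) ≡ pure1
    V-sk-pure1 = status-pure1 V box-sk V-sk

    round-trip-k : column (res k V) k ≐[ k ] column (flip T) k
    round-trip-k {i} b = trans (proj₁ (res-M1 k V V-k-mixed V-sk-pure1) i) (sym (flip-pure2 T pure2-k b))

    round-trip-sk : column (res k V) (suc k) ≐[ suc k ] column (flip T) (suc k)
    round-trip-sk {i} b = begin
      res k V i (suc k)                   ≡⟨ proj₂ (res-M1 k V V-k-mixed V-sk-pure1) i ⟩
      profile (sep V k) (V (sep V k) k) i ≡⟨ sep-of-profile V (λ _ → V-k _) (window-map proj₂ window) i ⟩
      P i                                 ≡⟨ T-sk b ⟨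
      T i (suc k)                         ≡⟨ flip-mixed T mixed-sk i ⟨
      flip T i (suc k)                    ∎

    properties : ResProperties T k
    properties =
        swap-statistics swap singleton-c2 (window-exchangeable window)
      , (V-descent , res-flip-res≐flip round-trip-k round-trip-sk)
      , ℓ-swap box-k box-sk (res-off k T) pure2-k mixed-sk U-k-mixed U-sk-pure2 z<s

  module Case21 {T k i₀} (box-k : Box i₀ k) (box-sk : Box i₀ (suc k))
                (pure2-k : status T k ≡ pure2) (pure1-sk : status T (suc k) ≡ pure1) where

    U : Filling
    U = res k T

    U-k : ∀ i → U i k ≡ c1
    U-k = proj₁ (res-21 k T pure2-k pure1-sk)

    U-sk : ∀ i → U i (suc k) ≡ c2
    U-sk = proj₂ (res-21 k T pure2-k pure1-sk)

    swap : ColumnSwap T U k (suc k) (const c2) c1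
    swap = record
      { distinct = ≢-sym 1+n≢n ; shared = i₀ , box-k , box-sk
      ; X-j = pure2-column T pure2-k ; X-j′ = pure1-column T pure1-sk
      ; Y-j = λ _ → U-k _ ; Y-j′ = λ _ → U-sk _ ; elsewhere = res-off k T }

    U-k-pure1 : status U k ≡ pure1
    U-k-pure1 = status-pure1 U box-k (λ _ → U-k _)

    U-sk-pure2 : status U (suc k) ≡ pure2
    U-sk-pure2 = status-pure2 U box-sk (λ _ → U-sk _)

    V : Filling
    V = flip U

    V-k : column V k ≐[ k ] const c2
    V-k = flip-pure1 U U-k-pure1

    V-sk : column V (suc k) ≐[ suc k ] const c1
    V-sk = flip-pure2 U U-sk-pure2

    V-descent : Descent V k
    V-descent = i₀ , inShape box-k , inShape box-sk , cong cmax (V-k box-k) , cong cmin (V-sk box-sk)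

    V-k-pure2 : status V k ≡ pure2
    V-k-pure2 = status-pure2 V box-k V-k

    V-sk-pure1 : status V (suc k) ≡ pure1
    V-sk-pure1 = status-pure1 V box-sk V-sk

    round-trip-k : column (res k V) k ≐[ k ] column (flip T) k
    round-trip-k {i} b = trans (proj₁ (res-21 k V V-k-pure2 V-sk-pure1) i) (sym (flip-pure2 T pure2-k b))

    round-trip-sk : column (res k V) (suc k) ≐[ suc k ] column (flip T) (suc k)
    round-trip-sk {i} b = trans (proj₂ (res-21 k V V-k-pure2 V-sk-pure1) i) (sym (flip-pure1 T pure1-sk b))

    properties : ResProperties T k
    properties =
        swap-statistics swap singleton-c1 (constant-exchangeable box-k box-sk singleton-c2)
      , (V-descent , res-flip-res≐flip round-trip-k round-trip-sk)
      , ℓ-swap box-k box-sk (res-off k T) pure2-k pure1-sk U-k-pure1 U-sk-pure2 z<s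

  -- Both seps would equal the descent row, which then holds {1,2} in column k + 1.
  benign-descent-not-mixed-mixed : ∀ {T k i₀} → Is12SV T → Benign T → Box i₀ k → Box i₀ (suc k) →
    T i₀ k ≢ c1 → T i₀ (suc k) ≢ c2 → status T k ≡ mixed → status T (suc k) ≡ mixed → ⊥
  benign-descent-not-mixed-mixed {T} {k} {i₀} sv benign box-k box-sk i₀≢c1 i₀≢c2 mixed-k mixed-sk =
    <-irrefl refl (<-≤-trans sep-sk<sep-k (≤-trans sep-k≤i₀ i₀≤sep-sk))
    where
      window-sk : Window (λ x → Box x (suc k)) (sep T (suc k)) (T (sep T (suc k)) (suc k))
      window-sk = proj₂ (mixed-column-profile T sv mixed-sk)
      sep-k≤i₀ : sep T k ≤ i₀
      sep-k≤i₀ = ≮⇒≥ (i₀≢c1 ∘ proj₂ (proj₂ (sep-spec T box-k i₀≢c1)) box-k)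
      i₀≤sep-sk : i₀ ≤ sep T (suc k)
      i₀≤sep-sk = profile-≢c2⇒≤ (i₀≢c2 ∘ trans (proj₁ (mixed-column-profile T sv mixed-sk) box-sk))
      ordered : sep T (suc k) ≤ sep T k × (Has12 T (suc k) → sep T (suc k) < sep T k)
      ordered = benign k (suc k) mixed-k mixed-sk (n<1+n k)
                  λ m k<m m<sk _ → <-irrefl refl (<-≤-trans k<m (≤-pred m<sk))
      sep-sk≡i₀ : sep T (suc k) ≡ i₀
      sep-sk≡i₀ = ≤-antisym (≤-trans (proj₁ ordered) sep-k≤i₀) i₀≤sep-sk
      i₀≡c12 : T i₀ (suc k) ≡ c12
      i₀≡c12 = ≢c1∧≢c2⇒≡c12 (subst (λ x → T x (suc k) ≢ c1) sep-sk≡i₀ (window-≢c1 window-sk)) i₀≢c2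
      sep-sk<sep-k : sep T (suc k) < sep T k
      sep-sk<sep-k = proj₂ ordered (i₀ , inShape box-sk , i₀≡c12)

  descent-properties : ∀ {T k i₀} → Is12SV T → Benign T → Box i₀ k → Box i₀ (suc k) →
    T i₀ k ≢ c1 → T i₀ (suc k) ≢ c2 → ResProperties T k
  descent-properties {T} sv benign box-k box-sk i₀≢c1 i₀≢c2
    with status-≢c1 T box-k i₀≢c1 | status-≢c2 T box-sk i₀≢c2
  ... | inj₁ mixed-k | inj₁ mixed-sk =
    ⊥-elim (benign-descent-not-mixed-mixed sv benign box-k box-sk i₀≢c1 i₀≢c2 mixed-k mixed-sk)
  ... | inj₁ mixed-k | inj₂ pure1-sk = CaseM1.properties sv box-k box-sk i₀≢c1 mixed-k pure1-sk
  ... | inj₂ pure2-k | inj₁ mixed-sk = Case2M.properties sv box-k box-sk i₀≢c2 pure2-k mixed-sk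
  ... | inj₂ pure2-k | inj₂ pure1-sk = Case21.properties box-k box-sk pure2-k pure1-sk

  res-properties : ∀ {T k} → Is12SV T → Benign T → Descent T k → ResProperties T k
  res-properties sv benign (_ , in-k , in-sk , max≡2 , min≡1) =
    descent-properties sv benign (box in-k) (box in-sk) (cmax≡2⇒≢c1 max≡2) (cmin≡1⇒≢c2 min≡1)

open Defs using (ceq; ex; ircont; res; flip; Descent; _≐_; ℓ; Is12SV; Benign)

proposition2p6 : (lam mu : List ℕ) → IsPartition lam → IsPartition mu → mu ⊆ₚ lam →
    (T : Filling) → Is12SV lam mu T → Benign lam mu T →
    (k : ℕ) → Descent lam mu T k →
    ((∀ i → ceq lam mu (res lam mu k T) i ≡ ceq lam mu T i)
      × (∀ i → ex lam mu (res lam mu k T) i ≡ ex lam mu T i)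
      × (∀ r → ircont lam mu (res lam mu k T) r ≡ ircont lam mu T r))
    × (Descent lam mu (flip lam mu (res lam mu k T)) k
      × _≐_ lam mu (res lam mu k (flip lam mu (res lam mu k T))) (flip lam mu T))
    × ℓ lam mu (res lam mu k T) < ℓ lam mu T
proposition2p6 lam mu lam-partition mu-partition _ T sv benign k descent = res-properties sv benign descent
  where open SkewShape lam mu lam-partition mu-partition
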